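{- Let $m$ be a positive integer with $m\not\equiv 0\pmod 3$, let $n=2m$, and let $\delta\in\mathbb{F}_{2^n}$. Let $F(X)=(X^{2^m}+X+\delta)^{3\cdot 2^{2m-2}+2^{m-2}}+X$, viewed as a function $\mathbb{F}_{2^n}\to\mathbb{F}_{2^n}$. Then $F$ is P$c$N for every $c\in\mathbb{F}_{2^m}\setminus\{1\}$.
   Context: For $F:\mathbb{F}_q\to\mathbb{F}_q$ and $a,b,c\in\mathbb{F}_q$, let ${}_c\Delta_F(a,b)$ be the number of $X\in\mathbb{F}_q$ with $F(X+a)-cF(X)=b$. The $c$-differential uniformity of $F$ is ${}_c\Delta_F=\max\{{}_c\Delta_F(a,b): a,b\in\mathbb{F}_q,\ a\neq 0 \text{ if } c=1\}$. $F$ is perfect $c$-nonlinear (P$c$N) if ${}_c\Delta_F=1$. -}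

module Defs where

open import Level using (Level; suc; _⊔_)
open import Data.Nat using (ℕ; zero; suc; _+_; _*_; _∸_) renaming (_^_ to _^ℕ_; _⊔_ to _⊔ℕ_)
open import Data.Fin using (Fin)
open import Data.Fin.Properties using () renaming (_≟_ to _≟Fin_)
open import Data.List using ([]; _∷_; List; map; filter; length; foldr; concatMap; allFin)
open import Data.Product using (proj₁; proj₂; Σ; _×_; _,_; ∃)
open import Relation.Nullary using (¬_; Dec; yes; no)
open import Relation.Nullary.Decidable using (map′)
open import Relation.Binary.PropositionalEquality using (_≡_; _≢_; cong; trans; sym)
open import Algebra.Structures using (IsCommutativeRing)
open import Function.Bundles using (_↔_; Inverse)

record FiniteField (q : ℕ) : Set₁ where
  infixl 6 _+F_ _-F_
  infixl 7 _*F_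
  field
    Carrier   : Set
    _+F_ _*F_ : Carrier → Carrier → Carrier
    -F_       : Carrier → Carrier
    0F 1F     : Carrier
    isCommutativeRing : IsCommutativeRing _≡_ _+F_ _*F_ -F_ 0F 1F
    0≢1       : 0F ≢ 1F
    inverse   : ∀ x → x ≢ 0F → Σ Carrier (λ y → x *F y ≡ 1F)
    enum      : Carrier ↔ Fin q

  _-F_ : Carrier → Carrier → Carrier
  x -F y = x +F (-F y)

  _^F_ : Carrier → ℕ → Carrier
  x ^F zero  = 1F
  x ^F suc k = x *F (x ^F k)

  elements : List Carrier
  elements = map (Inverse.from enum) (allFin q)

  _≟_ : (x y : Carrier) → Dec (x ≡ y)
  x ≟ y = map′ (λ e → trans (sym (Inverse.inverseʳ enum {x} _≡_.refl))
                        (trans (cong (Inverse.from enum) e) (Inverse.inverseʳ enum {y} _≡_.refl)))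
               (cong (Inverse.to enum))
               (Inverse.to enum x ≟Fin Inverse.to enum y)

  cΔ : (Carrier → Carrier) → Carrier → Carrier → Carrier → ℕ
  cΔ F c a b = length (filter (λ X → (F (X +F a) -F (c *F F X)) ≟ b) elements)

  admissible : Carrier → List (Carrier × Carrier)
  admissible c = concatMap (λ a → concatMap (λ b → pick a b) elements) elements
    where
    pick : Carrier → Carrier → List (Carrier × Carrier)
    pick a b with c ≟ 1F | a ≟ 0F
    ... | yes _ | yes _ = []
    ... | _     | _     = (a , b) ∷ []

  cDiffUniformity : (Carrier → Carrier) → Carrier → ℕ
  cDiffUniformity F c = foldr (λ p m → cΔ F c (proj₁ p) (proj₂ p) ⊔ℕ m) 0 (admissible c)

  PcN : (Carrier → Carrier) → Carrier → Set
  PcN F c = cDiffUniformity F c ≡ 1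

-- For m = 1
-- (n = 2) the paper's 2^(m-2) = 2^(-1) is read, as exponents of power maps
-- on F_{2^n}, as the inverse of 2 modulo 2^n - 1, i.e. 2^(n-1) = 2^(2m-1) = 2.
pow2mMinus2 : ℕ → ℕ
pow2mMinus2 zero          = 0   -- unused (m positive)
pow2mMinus2 (suc zero)    = 2
pow2mMinus2 (suc (suc k)) = 2 ^ℕ k

expo : ℕ → ℕ
expo m = 3 * (2 ^ℕ (2 * m ∸ 2)) + pow2mMinus2 m

Fmap : ∀ {q} (K : FiniteField q) → ℕ → FiniteField.Carrier K → FiniteField.Carrier K → FiniteField.Carrier K
Fmap K m δ X = (((X ^F (2 ^ℕ m)) +F X) +F δ) ^F expo m +F X
  where open FiniteField K

-- Write x̄ = x ^ 2^m and tr x = x̄ + x on 𝔽_{2^{2m}}, so that F X = G (tr X + δ) + X with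
-- G y = y ^ (3·2^{2m-2} + 2^{m-2}).  The exponent gives (G y)⁴ = y³ ȳ, hence (tr (G y))⁴ = y ȳ (tr y)².
-- The c-derivative X ↦ F (X + a) - c F X equals H (tr X) + (1 + c) X + a for some H, and since c
-- lies in 𝔽_{2^m}, the fourth power of the trace of H (tr X) + (1 + c) X is (1 + c)⁴ L (tr X) plus a
-- constant, where L u = u⁴ + τ² u² + τ³ u with τ = tr δ.  L is additive, and a nonzero root s of L in
-- 𝔽_{2^m} would make s / τ a root of X³ + X + 1 in 𝔽_{2^m}, impossible as 3 ∤ m.  Hence equal values of
-- the derivative force equal traces and then equal arguments, so each derivative is a bijection.

module Submission where

open import Defs
open import Data.Nat using (ℕ; _*_; _^_; _%_; _≤_)
open import Relation.Binary.PropositionalEquality using (_≡_; _≢_)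

open import Level using (0ℓ)
open import Data.Nat using (zero; suc; _+_; _∸_; _/_; _⊔_; _<_; s≤s)
import Data.Nat.Properties as ℕ
open import Data.Nat.Tactic.RingSolver using (solve-∀)
open import Data.Nat.DivMod using (m≡m%n+[m/n]*n; m%n<n)
open import Data.Bool using (Bool; true; false)
import Data.Bool.Properties as Bool
open import Data.Empty using (⊥; ⊥-elim)
open import Data.Fin as Fin using (Fin)
import Data.Fin.Properties as Finₚ
open import Data.List using ([]; _∷_; filter; length; foldr; tabulate)
import Data.List.Properties as List
open import Data.List.Relation.Unary.All.Properties using (tabulate⁺)
import Data.Maybe as Maybe
open import Data.Product using (∃; _,_; proj₁; proj₂)
open import Data.Vec.Functional using (Vector; replicate)
open import Function using (_∘_; id; _↔_; mk↔ₛ′; Inverse)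
open import Function.Definitions using (Injective)
open import Function.Construct.Composition using (_↔-∘_)
open import Function.Construct.Symmetry using (↔-sym)
open import Function.Bundles using (Injection)
open import Function.Properties.Inverse using (↔⇒↣)
open import Relation.Nullary using (¬_; yes; no)
open import Data.List.Relation.Unary.All using (All)
open import Relation.Unary using (Pred; Decidable)
open import Relation.Binary.PropositionalEquality
  using (refl; sym; trans; cong; cong₂; module ≡-Reasoning)
open import Relation.Binary.Consequences using (dec⇒weaklyDec)
open import Algebra.Bundles using (CommutativeRing; CommutativeMonoid)
open import Algebra.Structures using (IsCommutativeRing)
open import Algebra.Solver.Ring.AlmostCommutativeRing
  using (fromCommutativeRing; _-Raw-AlmostCommutative⟶_)
import Algebra.Properties.Group as GroupProperties
import Algebra.Properties.CommutativeSemigroup as CommutativeSemigroupProperties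
import Algebra.Properties.Semiring.Mult as SemiringMult
import Algebra.Properties.CommutativeMonoid.Sum as CommutativeMonoidSum
import Algebra.Solver.Ring as RingSolver

open ≡-Reasoning

module FieldProperties {q : ℕ} (K : FiniteField q) where
  open FiniteField K public
  open IsCommutativeRing isCommutativeRing public
    using (+-comm; *-comm; *-assoc; +-identityˡ; +-identityʳ
          ; *-identityˡ; *-identityʳ; zeroˡ; zeroʳ)

  commutativeRing : CommutativeRing 0ℓ 0ℓ
  commutativeRing = record { isCommutativeRing = isCommutativeRing }

  open GroupProperties (CommutativeRing.+-group commutativeRing) public
    using (inverseʳ-unique; //-rightDividesˡ; //-rightDividesʳ)
    renaming (∙-cancelˡ to +-cancelˡ; ∙-cancelʳ to +-cancelʳ)
  open CommutativeSemigroupProperties (CommutativeRing.*-commutativeSemigroup commutativeRing)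
    using () renaming (interchange to *-interchange)

  ^-homo-* : ∀ x m n → x ^F (m + n) ≡ x ^F m *F x ^F n
  ^-homo-* x zero    n = sym (*-identityˡ _)
  ^-homo-* x (suc m) n = trans (cong (x *F_) (^-homo-* x m n)) (sym (*-assoc _ _ _))

  ^-assocʳ : ∀ x m n → (x ^F m) ^F n ≡ x ^F (m * n)
  ^-assocʳ x m zero    = cong (x ^F_) (sym (ℕ.*-zeroʳ m))
  ^-assocʳ x m (suc n) = begin
    x ^F m *F (x ^F m) ^F n  ≡⟨ cong (x ^F m *F_) (^-assocʳ x m n) ⟩
    x ^F m *F x ^F (m * n)   ≡⟨ ^-homo-* x m (m * n) ⟨
    x ^F (m + m * n)         ≡⟨ cong (x ^F_) (ℕ.*-suc m n) ⟨
    x ^F (m * suc n)         ∎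

  ^-comm : ∀ x m n → (x ^F m) ^F n ≡ (x ^F n) ^F m
  ^-comm x m n = begin
    (x ^F m) ^F n  ≡⟨ ^-assocʳ x m n ⟩
    x ^F (m * n)   ≡⟨ cong (x ^F_) (ℕ.*-comm m n) ⟩
    x ^F (n * m)   ≡⟨ ^-assocʳ x n m ⟨
    (x ^F n) ^F m  ∎

  ^-distrib-* : ∀ x y n → (x *F y) ^F n ≡ x ^F n *F y ^F n
  ^-distrib-* x y zero    = sym (*-identityˡ 1F)
  ^-distrib-* x y (suc n) =
    trans (cong ((x *F y) *F_) (^-distrib-* x y n)) (*-interchange x y (x ^F n) (y ^F n))

  1^n≡1 : ∀ n → 1F ^F n ≡ 1F
  1^n≡1 zero    = refl
  1^n≡1 (suc n) = trans (*-identityˡ _) (1^n≡1 n)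

  frobenius-period : ∀ {x} p → x ^F (2 ^ p) ≡ x → ∀ r j → x ^F (2 ^ (r + j * p)) ≡ x ^F (2 ^ r)
  frobenius-period {x} p x^2^p≡x r zero    = cong (λ e → x ^F (2 ^ e)) (ℕ.+-identityʳ r)
  frobenius-period {x} p x^2^p≡x r (suc j) = begin
    x ^F (2 ^ (r + (p + j * p)))      ≡⟨ cong (λ e → x ^F (2 ^ e)) (r+[p+n]≡r+n+p r p (j * p)) ⟩
    x ^F (2 ^ (n + p))                ≡⟨ cong (x ^F_) (ℕ.^-distribˡ-+-* 2 n p) ⟩
    x ^F (2 ^ n * 2 ^ p)              ≡⟨ ^-assocʳ x (2 ^ n) (2 ^ p) ⟨
    (x ^F (2 ^ n)) ^F (2 ^ p)         ≡⟨ ^-comm x (2 ^ n) (2 ^ p) ⟩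
    (x ^F (2 ^ p)) ^F (2 ^ n)         ≡⟨ cong (_^F (2 ^ n)) x^2^p≡x ⟩
    x ^F (2 ^ n)                      ≡⟨ frobenius-period p x^2^p≡x r j ⟩
    x ^F (2 ^ r)                      ∎
    where
    n : ℕ
    n = r + j * p
    r+[p+n]≡r+n+p : ∀ r p n → r + (p + n) ≡ r + n + p
    r+[p+n]≡r+n+p r p n = trans (cong (r +_) (ℕ.+-comm p n)) (sym (ℕ.+-assoc r n p))

  -- 2 ^ (2 * m) unfolds to 2 * (2 * 2 ^ (2 * m ∸ 2)) when m ≥ 2.
  [y^expo]⁴≡y³y^[2^m] : ∀ m → 1 ≤ m → (∀ y → y ^F (2 ^ (2 * m)) ≡ y) →
                        ∀ y → (y ^F expo m) ^F 4 ≡ y ^F 3 *F y ^F (2 ^ m)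
  [y^expo]⁴≡y³y^[2^m] 1 _ x^4≡x y = begin
    (y ^F 5) ^F 4                   ≡⟨ ^-assocʳ y 5 4 ⟩
    y ^F (12 + 8)                   ≡⟨ ^-homo-* y 12 8 ⟩
    y ^F 12 *F y ^F 8               ≡⟨ cong₂ _*F_ (^-assocʳ y 4 3) (^-assocʳ y 4 2) ⟨
    (y ^F 4) ^F 3 *F (y ^F 4) ^F 2  ≡⟨ cong₂ (λ a b → a ^F 3 *F b ^F 2) (x^4≡x y) (x^4≡x y) ⟩
    y ^F 3 *F y ^F 2                ∎
  [y^expo]⁴≡y³y^[2^m] m@(suc (suc j)) _ x^[2^2m]≡x y = begin
    (y ^F expo m) ^F 4                        ≡⟨ ^-assocʳ y (expo m) 4 ⟩
    y ^F (expo m * 4)                         ≡⟨ cong (y ^F_) (expo-times-4 (2 ^ (2 * m ∸ 2)) (2 ^ j)) ⟩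
    y ^F (2 ^ (2 * m) * 3 + 2 ^ m)            ≡⟨ ^-homo-* y (2 ^ (2 * m) * 3) (2 ^ m) ⟩
    y ^F (2 ^ (2 * m) * 3) *F y ^F (2 ^ m)    ≡⟨ cong (_*F y ^F (2 ^ m)) (^-assocʳ y (2 ^ (2 * m)) 3) ⟨
    (y ^F (2 ^ (2 * m))) ^F 3 *F y ^F (2 ^ m) ≡⟨ cong (λ a → a ^F 3 *F y ^F (2 ^ m)) (x^[2^2m]≡x y) ⟩
    y ^F 3 *F y ^F (2 ^ m)                    ∎
    where
    expo-times-4 : ∀ a b → (3 * a + b) * 4 ≡ 2 * (2 * a) * 3 + 2 * (2 * b)
    expo-times-4 = solve-∀

  *-cancelˡ : ∀ {x} y z → x ≢ 0F → x *F y ≡ x *F z → y ≡ z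
  *-cancelˡ {x} y z x≢0 xy≡xz = begin
    y              ≡⟨ *-identityˡ y ⟨
    1F *F y        ≡⟨ cong (_*F y) x⁻¹x≡1 ⟨
    x⁻¹ *F x *F y  ≡⟨ *-assoc x⁻¹ x y ⟩
    x⁻¹ *F (x *F y) ≡⟨ cong (x⁻¹ *F_) xy≡xz ⟩
    x⁻¹ *F (x *F z) ≡⟨ *-assoc x⁻¹ x z ⟨
    x⁻¹ *F x *F z  ≡⟨ cong (_*F z) x⁻¹x≡1 ⟩
    1F *F z        ≡⟨ *-identityˡ z ⟩
    z              ∎
    where
    x⁻¹ : Carrier
    x⁻¹ = proj₁ (inverse x x≢0)
    x⁻¹x≡1 : x⁻¹ *F x ≡ 1F
    x⁻¹x≡1 = trans (*-comm x⁻¹ x) (proj₂ (inverse x x≢0))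

  x*y≡0⇒y≡0 : ∀ {x y} → x ≢ 0F → x *F y ≡ 0F → y ≡ 0F
  x*y≡0⇒y≡0 {x} {y} x≢0 xy≡0 = *-cancelˡ y 0F x≢0 (trans xy≡0 (sym (zeroʳ x)))

  x*y≢0 : ∀ {x y} → x ≢ 0F → y ≢ 0F → x *F y ≢ 0F
  x*y≢0 x≢0 y≢0 xy≡0 = y≢0 (x*y≡0⇒y≡0 x≢0 xy≡0)

  x^n≢0 : ∀ {x} n → x ≢ 0F → x ^F n ≢ 0F
  x^n≢0 zero    x≢0 = 0≢1 ∘ sym
  x^n≢0 (suc n) x≢0 = x*y≢0 x≢0 (x^n≢0 n x≢0)

  no-common-zero : ∀ a b u v → a *F u +F b *F v ≡ 1F → u ≡ 0F → v ≡ 0F → ⊥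
  no-common-zero a b u v bezout u≡0 v≡0 = 0≢1 (begin
    0F                   ≡⟨ +-identityʳ 0F ⟨
    0F +F 0F             ≡⟨ cong₂ _+F_ (zeroʳ a) (zeroʳ b) ⟨
    a *F 0F +F b *F 0F   ≡⟨ cong₂ (λ u v → a *F u +F b *F v) u≡0 v≡0 ⟨
    a *F u +F b *F v     ≡⟨ bezout ⟩
    1F                   ∎)

  fixed-inverse : ∀ {x y} n → x ^F n ≡ x → x *F y ≡ 1F → y ^F n ≡ y
  fixed-inverse {x} {y} n xⁿ≡x xy≡1 = *-cancelˡ (y ^F n) y x≢0 (begin
    x *F y ^F n        ≡⟨ cong (_*F y ^F n) xⁿ≡x ⟨
    x ^F n *F y ^F n   ≡⟨ ^-distrib-* x y n ⟨
    (x *F y) ^F n      ≡⟨ cong (_^F n) xy≡1 ⟩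
    1F ^F n            ≡⟨ 1^n≡1 n ⟩
    1F                 ≡⟨ xy≡1 ⟨
    x *F y             ∎)
    where
    x≢0 : x ≢ 0F
    x≢0 x≡0 = 0≢1 (trans (sym (zeroˡ y)) (trans (cong (_*F y) (sym x≡0)) xy≡1))

  translation : Carrier → Carrier ↔ Carrier
  translation a = mk↔ₛ′ (_+F a) (_-F a) (//-rightDividesˡ a) (//-rightDividesʳ a)

  scaling : ∀ x → x ≢ 0F → Carrier ↔ Carrier
  scaling x x≢0 = mk↔ₛ′ (x *F_) (x⁻¹ *F_) (cancel x x⁻¹ xx⁻¹≡1) (cancel x⁻¹ x x⁻¹x≡1)
    where
    x⁻¹ : Carrier
    x⁻¹ = proj₁ (inverse x x≢0)
    xx⁻¹≡1 : x *F x⁻¹ ≡ 1F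
    xx⁻¹≡1 = proj₂ (inverse x x≢0)
    x⁻¹x≡1 : x⁻¹ *F x ≡ 1F
    x⁻¹x≡1 = trans (*-comm x⁻¹ x) xx⁻¹≡1
    cancel : ∀ u v → u *F v ≡ 1F → ∀ y → u *F (v *F y) ≡ y
    cancel u v uv≡1 y = trans (sym (*-assoc u v y)) (trans (cong (_*F y) uv≡1) (*-identityˡ y))


module Sums {q : ℕ} (K : FiniteField q) {a ℓ} (M : CommutativeMonoid a ℓ) where
  open FiniteField K using (Carrier; enum)
  open CommutativeMonoid M using (_≈_) renaming (Carrier to A; trans to ≈-trans; reflexive to ≈-reflexive)
  open CommutativeMonoidSum M using (sum; sum-permute; sum-cong-≗)

  ∑ : (Carrier → A) → A
  ∑ f = sum (f ∘ Inverse.from enum)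

  ∑-reindex : (σ : Carrier ↔ Carrier) (f : Carrier → A) → ∑ f ≈ ∑ (f ∘ Inverse.to σ)
  ∑-reindex σ f = ≈-trans (sum-permute (f ∘ Inverse.from enum) π)
    (≈-reflexive (sum-cong-≗ (cong f ∘ Inverse.strictlyInverseʳ enum ∘ Inverse.to σ ∘ Inverse.from enum)))
    where
    π : Fin q ↔ Fin q
    π = enum ↔-∘ (σ ↔-∘ ↔-sym enum)

module Characteristic {q : ℕ} (K : FiniteField q) where
  open FieldProperties K
  private
    +-commutativeMonoid : CommutativeMonoid 0ℓ 0ℓ
    +-commutativeMonoid = CommutativeRing.+-commutativeMonoid commutativeRing
  open Sums K +-commutativeMonoid
  open CommutativeMonoidSum +-commutativeMonoid using (sum-replicate; ∑-distrib-+)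
  open SemiringMult (CommutativeRing.semiring commutativeRing) using (_×_; ×1-homo-*)

  q×x≡0 : ∀ x → q × x ≡ 0F
  q×x≡0 x = +-cancelˡ (∑ id) (q × x) 0F (begin
    ∑ id +F q × x              ≡⟨ cong (∑ id +F_) (sum-replicate q) ⟨
    ∑ id +F ∑ (λ _ → x)        ≡⟨ ∑-distrib-+ (Inverse.from enum) (λ _ → x) ⟨
    ∑ (_+F x)                  ≡⟨ ∑-reindex (translation x) id ⟨
    ∑ id                       ≡⟨ +-identityʳ (∑ id) ⟨
    ∑ id +F 0F                 ∎)

  2^n×1≡[1+1]^n : ∀ n → (2 ^ n) × 1F ≡ (1F +F 1F) ^F n
  2^n×1≡[1+1]^n zero    = +-identityʳ 1F
  2^n×1≡[1+1]^n (suc n) = begin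
    (2 * 2 ^ n) × 1F                   ≡⟨ ×1-homo-* 2 (2 ^ n) ⟩
    (2 × 1F) *F ((2 ^ n) × 1F)         ≡⟨ cong₂ _*F_ (cong (1F +F_) (+-identityʳ 1F)) (2^n×1≡[1+1]^n n) ⟩
    (1F +F 1F) *F (1F +F 1F) ^F n      ∎

  characteristic-two : ∀ n → 1 ≤ n → q ≡ 2 ^ n → 1F +F 1F ≡ 0F
  characteristic-two (suc n) _ q≡2ⁿ⁺¹ with (1F +F 1F) ≟ 0F
  ... | yes 1+1≡0 = 1+1≡0
  ... | no  1+1≢0 = ⊥-elim (x^n≢0 (suc n) 1+1≢0 (begin
    (1F +F 1F) ^F suc n  ≡⟨ 2^n×1≡[1+1]^n (suc n) ⟨
    (2 ^ suc n) × 1F     ≡⟨ cong (_× 1F) q≡2ⁿ⁺¹ ⟨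
    q × 1F               ≡⟨ q×x≡0 1F ⟩
    0F                   ∎))

private
  module Fermat {k : ℕ} (K : FiniteField (suc k)) where
    open FieldProperties K
    private
      *-commutativeMonoid : CommutativeMonoid 0ℓ 0ℓ
      *-commutativeMonoid = CommutativeRing.*-commutativeMonoid commutativeRing
    open Sums K *-commutativeMonoid renaming (∑ to ∏; ∑-reindex to ∏-reindex)
    open CommutativeMonoidSum *-commutativeMonoid
      using (sum-remove; sum-replicate; sum-cong-≗; ∑-distrib-+) renaming (sum to product)
    open import Algebra.Definitions.RawMonoid (CommutativeRing.*-rawMonoid commutativeRing)
      using (_×_)

    from : Fin (suc k) → Carrier
    from = Inverse.from enum

    n×x≡x^n : ∀ n x → n × x ≡ x ^F n
    n×x≡x^n zero    x = refl
    n×x≡x^n (suc n) x = cong (x *F_) (n×x≡x^n n x)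

    product-≢0 : ∀ n (v : Vector Carrier n) → (∀ i → v i ≢ 0F) → product v ≢ 0F
    product-≢0 zero    v v≢0 = 0≢1 ∘ sym
    product-≢0 (suc n) v v≢0 = x*y≢0 (v≢0 Fin.zero) (product-≢0 n (v ∘ Fin.suc) (v≢0 ∘ Fin.suc))

    -- Replacing the factor 0 by 1 makes y ↦ x * y change ∏ φ by the factor ∏ (ψ x) = x ^ k.
    φ : Carrier → Carrier
    φ y with y ≟ 0F
    ... | yes _ = 1F
    ... | no  _ = y

    ψ : Carrier → Carrier → Carrier
    ψ x y with y ≟ 0F
    ... | yes _ = 1F
    ... | no  _ = x

    φ≢0 : ∀ y → φ y ≢ 0F
    φ≢0 y with y ≟ 0F
    ... | yes _  = 0≢1 ∘ sym
    ... | no y≢0 = y≢0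

    φ-scale : ∀ {x} → x ≢ 0F → ∀ y → φ (x *F y) ≡ ψ x y *F φ y
    φ-scale {x} x≢0 y with y ≟ 0F | (x *F y) ≟ 0F
    ... | yes _   | yes _    = sym (*-identityˡ 1F)
    ... | yes y≡0 | no xy≢0  = ⊥-elim (xy≢0 (trans (cong (x *F_) y≡0) (zeroʳ x)))
    ... | no  y≢0 | yes xy≡0 = ⊥-elim (x*y≢0 x≢0 y≢0 xy≡0)
    ... | no  _   | no  _    = refl

    ∏ψ≡x^k : ∀ x → ∏ (ψ x) ≡ x ^F k
    ∏ψ≡x^k x = begin
      ∏ (ψ x)                                       ≡⟨ sum-remove {i = i₀} (ψ x ∘ from) ⟩
      ψ x (from i₀) *F product (λ j → ψ x (from (Fin.punchIn i₀ j)))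
        ≡⟨ cong₂ _*F_ ψ-at-0 (sum-cong-≗ ψ-elsewhere) ⟩
      1F *F product (replicate k x)                 ≡⟨ *-identityˡ _ ⟩
      product (replicate k x)                       ≡⟨ sum-replicate k ⟩
      k × x                                         ≡⟨ n×x≡x^n k x ⟩
      x ^F k                                        ∎
      where
      i₀ : Fin (suc k)
      i₀ = Inverse.to enum 0F
      ψ-at-0 : ψ x (from i₀) ≡ 1F
      ψ-at-0 with from i₀ ≟ 0F
      ... | yes _   = refl
      ... | no  ≢0F = ⊥-elim (≢0F (Inverse.strictlyInverseʳ enum 0F))
      ψ-elsewhere : ∀ j → ψ x (from (Fin.punchIn i₀ j)) ≡ x
      ψ-elsewhere j with from (Fin.punchIn i₀ j) ≟ 0F
      ... | no  _   = refl
      ... | yes ≡0F = ⊥-elim (Finₚ.punchInᵢ≢i i₀ j (begin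
        Fin.punchIn i₀ j                             ≡⟨ Inverse.strictlyInverseˡ enum _ ⟨
        Inverse.to enum (from (Fin.punchIn i₀ j))    ≡⟨ cong (Inverse.to enum) ≡0F ⟩
        i₀                                           ∎))

    x^[1+k]≡x : ∀ x → x ^F suc k ≡ x
    x^[1+k]≡x x with x ≟ 0F
    ... | yes refl = zeroˡ _
    ... | no  x≢0  = trans (cong (x *F_) x^k≡1) (*-identityʳ x)
      where
      P : Carrier
      P = ∏ φ
      x^k≡1 : x ^F k ≡ 1F
      x^k≡1 = *-cancelˡ (x ^F k) 1F (product-≢0 (suc k) (φ ∘ from) (φ≢0 ∘ from)) (begin
        P *F x ^F k               ≡⟨ *-comm P _ ⟩
        x ^F k *F P               ≡⟨ cong (_*F P) (∏ψ≡x^k x) ⟨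
        ∏ (ψ x) *F P              ≡⟨ ∑-distrib-+ (ψ x ∘ from) (φ ∘ from) ⟨
        ∏ (λ y → ψ x y *F φ y)    ≡⟨ sum-cong-≗ (φ-scale x≢0 ∘ from) ⟨
        ∏ (φ ∘ (x *F_))           ≡⟨ ∏-reindex (scaling x x≢0) φ ⟨
        P                         ≡⟨ *-identityʳ P ⟨
        P *F 1F                   ∎)

fermat : ∀ {q} (K : FiniteField q) x → FiniteField._^F_ K x q ≡ x
fermat {zero}  K x = ⊥-elim (Finₚ.¬Fin0 (Inverse.to (FiniteField.enum K) x))
fermat {suc k} K   = Fermat.x^[1+k]≡x K

injective⇒surjective : ∀ {n} (g : Fin n → Fin n) → Injective _≡_ _≡_ g → ∀ b → ∃ λ i → g i ≡ b
injective⇒surjective {zero}  g g-injective ()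
injective⇒surjective {suc n} g g-injective b with Finₚ.any? (λ i → g i Finₚ.≟ b)
... | yes hit  = hit
... | no  miss = ⊥-elim (ℕ.1+n≰n (Finₚ.injective⇒≤ h-injective))
  where
  b≢g : ∀ i → b ≢ g i
  b≢g i b≡gi = miss (i , sym b≡gi)
  h : Fin (suc n) → Fin n
  h i = Fin.punchOut (b≢g i)
  h-injective : Injective _≡_ _≡_ h
  h-injective {i} {j} = g-injective ∘ Finₚ.punchOut-injective (b≢g i) (b≢g j)

length-filter-tabulate-unique : ∀ {A : Set} {P : Pred A 0ℓ} (P? : Decidable P) {n} (f : Fin n → A) i →
  P (f i) → (∀ j → P (f j) → j ≡ i) → length (filter P? (tabulate f)) ≡ 1
length-filter-tabulate-unique {P = P} P? f Fin.zero Pfi unique = begin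
  length (filter P? (tabulate f))                       ≡⟨ cong length (List.filter-accept P? Pfi) ⟩
  suc (length (filter P? (tabulate (f ∘ Fin.suc))))     ≡⟨ cong (suc ∘ length) (List.filter-none P? none) ⟩
  1                                                     ∎
  where
  none : All (λ x → ¬ P x) (tabulate (f ∘ Fin.suc))
  none = tabulate⁺ (λ j Pfj → Finₚ.0≢1+n (sym (unique (Fin.suc j) Pfj)))
length-filter-tabulate-unique P? f (Fin.suc i) Pfi unique = begin
  length (filter P? (tabulate f))
    ≡⟨ cong length (List.filter-reject P? (Finₚ.0≢1+n ∘ unique Fin.zero)) ⟩
  length (filter P? (tabulate (f ∘ Fin.suc)))           ≡⟨ length-filter-tabulate-unique P? (f ∘ Fin.suc) i Pfi
                                                             (λ j → Finₚ.suc-injective ∘ unique (Fin.suc j)) ⟩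
  1                                                     ∎

foldr-⊔-constant : ∀ {B : Set} (g : B → ℕ) {k} → (∀ p → g p ≡ k) →
                   ∀ p ps → foldr (λ p m → g p ⊔ m) 0 (p ∷ ps) ≡ k
foldr-⊔-constant g {k} g≡k p []        = trans (ℕ.⊔-identityʳ (g p)) (g≡k p)
foldr-⊔-constant g {k} g≡k p (p′ ∷ ps) =
  trans (cong₂ _⊔_ (g≡k p) (foldr-⊔-constant g g≡k p′ ps)) (ℕ.⊔-idem k)

private
  module Counting {k : ℕ} (K : FiniteField (suc k)) where
    open FieldProperties K

    preimage-count-injective : (G : Carrier → Carrier) → Injective _≡_ _≡_ G →
      ∀ b → length (filter (λ X → G X ≟ b) elements) ≡ 1
    preimage-count-injective G G-injective b = begin
      length (filter P? elements)        ≡⟨ cong (length ∘ filter P?) (List.map-tabulate id from) ⟩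
      length (filter P? (tabulate from)) ≡⟨ length-filter-tabulate-unique P? from i G[from-i]≡b unique ⟩
      1                                  ∎
      where
      to : Carrier → Fin (suc k)
      to = Inverse.to enum
      from : Fin (suc k) → Carrier
      from = Inverse.from enum
      P? : Decidable (λ X → G X ≡ b)
      P? X = G X ≟ b
      g : Fin (suc k) → Fin (suc k)
      g = to ∘ G ∘ from
      g-injective : Injective _≡_ _≡_ g
      g-injective = Injection.injective (↔⇒↣ (↔-sym enum))
                  ∘ G-injective ∘ Injection.injective (↔⇒↣ enum)
      i : Fin (suc k)
      i = proj₁ (injective⇒surjective g g-injective (to b))
      G[from-i]≡b : G (from i) ≡ b
      G[from-i]≡b = Injection.injective (↔⇒↣ enum) (proj₂ (injective⇒surjective g g-injective (to b)))
      unique : ∀ j → G (from j) ≡ b → j ≡ i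
      unique j G[from-j]≡b = g-injective (cong to (trans G[from-j]≡b (sym G[from-i]≡b)))

    admissible-nonempty : ∀ {c} → c ≢ 1F → ∃ λ p → ∃ λ ps → admissible c ≡ p ∷ ps
    admissible-nonempty {c} c≢1 with c ≟ 1F
    ... | yes c≡1 = ⊥-elim (c≢1 c≡1)
    ... | no  _   = _ , _ , refl

    PcN-if-derivatives-injective : ∀ F c → c ≢ 1F →
      (∀ a → Injective _≡_ _≡_ (λ X → F (X +F a) -F c *F F X)) → PcN F c
    PcN-if-derivatives-injective F c c≢1 derivative-injective with admissible-nonempty c≢1
    ... | p , ps , admissible≡p∷ps = trans (cong (foldr _ 0) admissible≡p∷ps)
      (foldr-⊔-constant _ (λ (a , b) → preimage-count-injective _ (derivative-injective a) b) p ps)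

PcN-if-derivatives-injective : ∀ {q} (K : FiniteField q) → let open FiniteField K in
  ∀ F c → c ≢ 1F → (∀ a → Injective _≡_ _≡_ (λ X → F (X +F a) -F c *F F X)) → PcN F c
PcN-if-derivatives-injective {zero}  K F c = ⊥-elim (Finₚ.¬Fin0 (Inverse.to (FiniteField.enum K) c))
PcN-if-derivatives-injective {suc k} K     = Counting.PcN-if-derivatives-injective K

module CharacteristicTwo {q : ℕ} (K : FiniteField q)
  (1+1≡0 : FiniteField._+F_ K (FiniteField.1F K) (FiniteField.1F K) ≡ FiniteField.0F K) where
  open FieldProperties K

  private
    𝔽₂ : CommutativeRing 0ℓ 0ℓ
    𝔽₂ = Bool.xor-∧-commutativeRing

    𝔽₂→K : Bool → Carrier
    𝔽₂→K false = 0F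
    𝔽₂→K true  = 1F

    𝔽₂-morphism : CommutativeRing.rawRing 𝔽₂ -Raw-AlmostCommutative⟶ fromCommutativeRing commutativeRing
    𝔽₂-morphism = record
      { ⟦_⟧    = 𝔽₂→K
      ; +-homo = λ where
          false false → sym (+-identityˡ 0F)
          false true  → sym (+-identityˡ 1F)
          true  false → sym (+-identityʳ 1F)
          true  true  → sym 1+1≡0
      ; *-homo = λ where
          false y → sym (zeroˡ (𝔽₂→K y))
          true  y → sym (*-identityˡ (𝔽₂→K y))
      ; -‿homo = λ where
          false → inverseʳ-unique 0F 0F (+-identityˡ 0F)
          true  → inverseʳ-unique 1F 1F 1+1≡0
      ; 0-homo = refl
      ; 1-homo = refl
      }

  -- Coefficients in 𝔽₂ let the ring solver use 1 + 1 = 0.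
  open RingSolver (CommutativeRing.rawRing 𝔽₂) (fromCommutativeRing commutativeRing) 𝔽₂-morphism
    (λ a b → Maybe.map (cong 𝔽₂→K) (dec⇒weaklyDec Bool._≟_ a b)) public
    using (solve; _:=_; _:+_; _:-_; _:*_; _:^_; con)

  x+y≡0⇒x≡y : ∀ {x y} → x +F y ≡ 0F → x ≡ y
  x+y≡0⇒x≡y {x} {y} x+y≡0 = begin
    x              ≡⟨ solve 2 (λ x y → x := x :+ y :+ y) refl x y ⟩
    x +F y +F y    ≡⟨ cong (_+F y) x+y≡0 ⟩
    0F +F y        ≡⟨ +-identityˡ y ⟩
    y              ∎

  x≡y⇒x+y≡0 : ∀ {x y} → x ≡ y → x +F y ≡ 0F
  x≡y⇒x+y≡0 {x} refl = solve 1 (λ x → x :+ x := con false) refl x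

  1+c≢0 : ∀ {c} → c ≢ 1F → 1F +F c ≢ 0F
  1+c≢0 c≢1 = c≢1 ∘ sym ∘ x+y≡0⇒x≡y

  frobenius-+ : ∀ n x y → (x +F y) ^F (2 ^ n) ≡ x ^F (2 ^ n) +F y ^F (2 ^ n)
  frobenius-+ zero    x y = solve 2 (λ x y → (x :+ y) :^ 1 := x :^ 1 :+ y :^ 1) refl x y
  frobenius-+ (suc n) x y = begin
    (x +F y) ^F (2 ^ suc n)        ≡⟨ ^-2^suc (x +F y) n ⟩
    ((x +F y) ^F (2 ^ n)) ^F 2     ≡⟨ cong (_^F 2) (frobenius-+ n x y) ⟩
    (x′ +F y′) ^F 2                ≡⟨ solve 2 (λ x y → (x :+ y) :^ 2 := x :^ 2 :+ y :^ 2) refl x′ y′ ⟩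
    x′ ^F 2 +F y′ ^F 2             ≡⟨ cong₂ _+F_ (^-2^suc x n) (^-2^suc y n) ⟨
    x ^F (2 ^ suc n) +F y ^F (2 ^ suc n) ∎
    where
    x′ y′ : Carrier
    x′ = x ^F (2 ^ n)
    y′ = y ^F (2 ^ n)
    ^-2^suc : ∀ x n → x ^F (2 ^ suc n) ≡ (x ^F (2 ^ n)) ^F 2
    ^-2^suc x n = trans (cong (x ^F_) (ℕ.*-comm 2 (2 ^ n))) (sym (^-assocʳ x (2 ^ n) 2))

  -- A root of X³ + X + 1 generates 𝔽₈, and 𝔽₈ meets 𝔽_{2^m} only in 𝔽₂ unless 3 divides m.
  cubic-root-fixed⇒3∣m : ∀ {w} m → w ^F 3 +F w +F 1F ≡ 0F → w ^F (2 ^ m) ≡ w → m % 3 ≡ 0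
  cubic-root-fixed⇒3∣m {w} m cubic w-fixed = r≡0 (m % 3) (m%n<n m 3) (begin
      w ^F (2 ^ (m % 3))                 ≡⟨ frobenius-period 3 w⁸≡w (m % 3) (m / 3) ⟨
      w ^F (2 ^ (m % 3 + m / 3 * 3))     ≡⟨ cong (λ e → w ^F (2 ^ e)) (m≡m%n+[m/n]*n m 3) ⟨
      w ^F (2 ^ m)                       ≡⟨ w-fixed ⟩
      w                                  ∎)
    where
    w⁸≡w : w ^F 8 ≡ w
    w⁸≡w = x+y≡0⇒x≡y (begin
      w ^F 8 +F w
        ≡⟨ solve 1 (λ w → w :^ 8 :+ w := w :* (w :^ 4 :+ w :^ 2 :+ w :+ con true) :* (w :^ 3 :+ w :+ con true)) refl w ⟩
      v *F (w ^F 3 +F w +F 1F)   ≡⟨ cong (v *F_) cubic ⟩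
      v *F 0F                    ≡⟨ zeroʳ v ⟩
      0F                         ∎)
      where
      v : Carrier
      v = w *F (w ^F 4 +F w ^F 2 +F w +F 1F)
    r≡0 : ∀ r → r < 3 → w ^F (2 ^ r) ≡ w → r ≡ 0
    r≡0 0 _ _    = refl
    r≡0 1 _ w²≡w = ⊥-elim (no-common-zero 1F (w +F 1F) _ _
      (solve 1 (λ w → con true :* (w :^ 3 :+ w :+ con true) :+ (w :+ con true) :* (w :^ 2 :+ w) := con true) refl w)
      cubic (x≡y⇒x+y≡0 w²≡w))
    r≡0 2 _ w⁴≡w = ⊥-elim (no-common-zero (w ^F 3 +F w ^F 2 +F 1F) (w ^F 2 +F w +F 1F) _ _
      (solve 1 (λ w → (w :^ 3 :+ w :^ 2 :+ con true) :* (w :^ 3 :+ w :+ con true)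
                      :+ (w :^ 2 :+ w :+ con true) :* (w :^ 4 :+ w) := con true) refl w)
      cubic (x≡y⇒x+y≡0 w⁴≡w))
    r≡0 (suc (suc (suc _))) (s≤s (s≤s (s≤s ())))

  linearized : Carrier → Carrier → Carrier
  linearized τ u = u ^F 4 +F τ ^F 2 *F u ^F 2 +F τ ^F 3 *F u

  linearized-+ : ∀ τ u v → linearized τ (u +F v) ≡ linearized τ u +F linearized τ v
  linearized-+ τ u v = solve 3 (λ τ u v →
      (u :+ v) :^ 4 :+ τ :^ 2 :* (u :+ v) :^ 2 :+ τ :^ 3 :* (u :+ v)
    := (u :^ 4 :+ τ :^ 2 :* u :^ 2 :+ τ :^ 3 :* u) :+ (v :^ 4 :+ τ :^ 2 :* v :^ 2 :+ τ :^ 3 :* v)) refl τ u v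

  linearized-root : ∀ {τ s} m → m % 3 ≢ 0 → τ ^F (2 ^ m) ≡ τ → s ^F (2 ^ m) ≡ s →
                    linearized τ s ≡ 0F → s ≡ 0F
  linearized-root {τ} {s} m 3∤m τ-fixed s-fixed Lτs≡0 with s ≟ 0F | τ ≟ 0F
  ... | yes s≡0 | _       = s≡0
  ... | no  s≢0 | yes τ≡0 = ⊥-elim (x^n≢0 4 s≢0 (begin
    s ^F 4
      ≡⟨ solve 1 (λ s → s :^ 4 := s :^ 4 :+ con false :^ 2 :* s :^ 2 :+ con false :^ 3 :* s) refl s ⟩
    linearized 0F s   ≡⟨ cong (λ τ → linearized τ s) τ≡0 ⟨
    linearized τ s    ≡⟨ Lτs≡0 ⟩
    0F                ∎))
  ... | no  s≢0 | no  τ≢0 = ⊥-elim (3∤m (cubic-root-fixed⇒3∣m m cubic w-fixed))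
    where
    τ⁻¹ : Carrier
    τ⁻¹ = proj₁ (inverse τ τ≢0)
    ττ⁻¹≡1 : τ *F τ⁻¹ ≡ 1F
    ττ⁻¹≡1 = proj₂ (inverse τ τ≢0)
    w : Carrier
    w = s *F τ⁻¹
    w≢0 : w ≢ 0F
    w≢0 = x*y≢0 s≢0 λ τ⁻¹≡0 → 0≢1 (trans (sym (zeroʳ τ)) (trans (cong (τ *F_) (sym τ⁻¹≡0)) ττ⁻¹≡1))
    w-fixed : w ^F (2 ^ m) ≡ w
    w-fixed = trans (^-distrib-* s τ⁻¹ (2 ^ m)) (cong₂ _*F_ s-fixed (fixed-inverse (2 ^ m) τ-fixed ττ⁻¹≡1))
    cubic : w ^F 3 +F w +F 1F ≡ 0F
    cubic = x*y≡0⇒y≡0 w≢0 (begin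
      w *F (w ^F 3 +F w +F 1F)
        ≡⟨ solve 1 (λ w → w :* (w :^ 3 :+ w :+ con true)
                        := w :* (w :^ 3 :+ w :* con true :^ 2 :+ con true :^ 3)) refl w ⟩
      w *F (w ^F 3 +F w *F 1F ^F 2 +F 1F ^F 3)
        ≡⟨ cong (λ e → w *F (w ^F 3 +F w *F e ^F 2 +F e ^F 3)) ττ⁻¹≡1 ⟨
      w *F (w ^F 3 +F w *F (τ *F τ⁻¹) ^F 2 +F (τ *F τ⁻¹) ^F 3)
        ≡⟨ solve 3 (λ s τ i → (s :* i) :* ((s :* i) :^ 3 :+ (s :* i) :* (τ :* i) :^ 2 :+ (τ :* i) :^ 3)
                            := (s :^ 4 :+ τ :^ 2 :* s :^ 2 :+ τ :^ 3 :* s) :* i :^ 4) refl s τ τ⁻¹ ⟩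
      linearized τ s *F τ⁻¹ ^F 4
        ≡⟨ cong (_*F τ⁻¹ ^F 4) Lτs≡0 ⟩
      0F *F τ⁻¹ ^F 4
        ≡⟨ zeroˡ _ ⟩
      0F ∎)

  linearized-injective : ∀ {τ u v} m → m % 3 ≢ 0 → τ ^F (2 ^ m) ≡ τ → u ^F (2 ^ m) ≡ u → v ^F (2 ^ m) ≡ v →
    linearized τ u ≡ linearized τ v → u ≡ v
  linearized-injective {τ} {u} {v} m 3∤m τ-fixed u-fixed v-fixed Lu≡Lv = x+y≡0⇒x≡y
    (linearized-root m 3∤m τ-fixed (trans (frobenius-+ m u v) (cong₂ _+F_ u-fixed v-fixed))
      (trans (linearized-+ τ u v) (x≡y⇒x+y≡0 Lu≡Lv)))

module QuadraticExtension {q : ℕ} (K : FiniteField q)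
  (1+1≡0 : FiniteField._+F_ K (FiniteField.1F K) (FiniteField.1F K) ≡ FiniteField.0F K)
  (m : ℕ) (1≤m : 1 ≤ m) (x^[2^2m]≡x : ∀ x → FiniteField._^F_ K x (2 ^ (2 * m)) ≡ x) where
  open FieldProperties K
  open CharacteristicTwo K 1+1≡0

  conj : Carrier → Carrier
  conj x = x ^F (2 ^ m)

  tr : Carrier → Carrier
  tr x = conj x +F x

  G : Carrier → Carrier
  G y = y ^F expo m

  conj-involutive : ∀ x → conj (conj x) ≡ x
  conj-involutive x = begin
    (x ^F (2 ^ m)) ^F (2 ^ m)   ≡⟨ ^-assocʳ x (2 ^ m) (2 ^ m) ⟩
    x ^F (2 ^ m * 2 ^ m)        ≡⟨ cong (x ^F_) (ℕ.^-distribˡ-+-* 2 m m) ⟨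
    x ^F (2 ^ (m + m))          ≡⟨ cong (λ e → x ^F (2 ^ (m + e))) (ℕ.+-identityʳ m) ⟨
    x ^F (2 ^ (2 * m))          ≡⟨ x^[2^2m]≡x x ⟩
    x                           ∎

  conj-+ : ∀ x y → conj (x +F y) ≡ conj x +F conj y
  conj-+ = frobenius-+ m

  conj-* : ∀ x y → conj (x *F y) ≡ conj x *F conj y
  conj-* x y = ^-distrib-* x y (2 ^ m)

  conj-fixed-+ : ∀ {x y} → conj x ≡ x → conj y ≡ y → conj (x +F y) ≡ x +F y
  conj-fixed-+ {x} {y} x-fixed y-fixed = trans (conj-+ x y) (cong₂ _+F_ x-fixed y-fixed)

  tr-fixed : ∀ x → conj (tr x) ≡ tr x
  tr-fixed x = begin
    conj (conj x +F x)          ≡⟨ conj-+ (conj x) x ⟩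
    conj (conj x) +F conj x     ≡⟨ cong (_+F conj x) (conj-involutive x) ⟩
    x +F conj x                 ≡⟨ +-comm x (conj x) ⟩
    tr x                        ∎

  tr-+ : ∀ x y → tr (x +F y) ≡ tr x +F tr y
  tr-+ x y = trans (cong (_+F (x +F y)) (conj-+ x y))
    (solve 4 (λ x′ y′ x y → x′ :+ y′ :+ (x :+ y) := x′ :+ x :+ (y′ :+ y)) refl (conj x) (conj y) x y)

  tr-*ˡ : ∀ {d} z → conj d ≡ d → tr (d *F z) ≡ d *F tr z
  tr-*ˡ {d} z d-fixed = trans (cong (_+F d *F z) (trans (conj-* d z) (cong (_*F conj z) d-fixed)))
    (solve 3 (λ d z′ z → d :* z′ :+ d :* z := d :* (z′ :+ z)) refl d (conj z) z)

  tr-shift : ∀ {s} y → conj s ≡ s → tr (s +F y) ≡ tr y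
  tr-shift {s} y s-fixed = trans (cong (_+F (s +F y)) (trans (conj-+ s y) (cong (_+F conj y) s-fixed)))
    (solve 3 (λ s y′ y → s :+ y′ :+ (s :+ y) := y′ :+ y) refl s (conj y) y)

  tr-G⁴ : ∀ y → tr (G y) ^F 4 ≡ y *F conj y *F tr y ^F 2
  tr-G⁴ y = begin
    (conj (G y) +F G y) ^F 4
      ≡⟨ solve 2 (λ a b → (a :+ b) :^ 4 := a :^ 4 :+ b :^ 4) refl (conj (G y)) (G y) ⟩
    conj (G y) ^F 4 +F G y ^F 4             ≡⟨ cong (_+F G y ^F 4) (^-comm (G y) (2 ^ m) 4) ⟩
    conj (G y ^F 4) +F G y ^F 4
      ≡⟨ cong (λ z → conj z +F z) ([y^expo]⁴≡y³y^[2^m] m 1≤m x^[2^2m]≡x y) ⟩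
    conj (y ^F 3 *F conj y) +F y ^F 3 *F conj y ≡⟨ cong (_+F y ^F 3 *F conj y) conj[y³ȳ] ⟩
    conj y ^F 3 *F y +F y ^F 3 *F conj y
      ≡⟨ solve 2 (λ y y′ → y′ :^ 3 :* y :+ y :^ 3 :* y′ := y :* y′ :* (y′ :+ y) :^ 2) refl y (conj y) ⟩
    y *F conj y *F tr y ^F 2                    ∎
    where
    conj[y³ȳ] : conj (y ^F 3 *F conj y) ≡ conj y ^F 3 *F y
    conj[y³ȳ] = trans (conj-* (y ^F 3) (conj y)) (cong₂ _*F_ (^-comm y 3 (2 ^ m)) (conj-involutive y))

  tr-G⁴-shift : ∀ {s} δ → conj s ≡ s → tr (G (s +F δ)) ^F 4 ≡ (s +F δ) *F (s +F conj δ) *F tr δ ^F 2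
  tr-G⁴-shift {s} δ s-fixed = trans (tr-G⁴ (s +F δ))
    (cong₂ (λ s+δ′ τ → (s +F δ) *F s+δ′ *F τ ^F 2)
           (trans (conj-+ s δ) (cong (_+F conj δ) s-fixed)) (tr-shift δ s-fixed))

  module Derivative (3∤m : m % 3 ≢ 0) (δ c : Carrier) (c-fixed : conj c ≡ c) (c≢1 : c ≢ 1F) (a : Carrier) where
    F : Carrier → Carrier
    F = Fmap K m δ

    Δ : Carrier → Carrier
    Δ X = F (X +F a) -F c *F F X

    τ t : Carrier
    τ = tr δ
    t = tr a

    H : Carrier → Carrier
    H u = G (u +F t +F δ) +F c *F G (u +F δ)

    Δ₀ : Carrier → Carrier
    Δ₀ X = H (tr X) +F (1F +F c) *F X

    κ : Carrier
    κ = τ ^F 2 *F (t ^F 2 +F t *F τ +F δ *F conj δ) +F c ^F 4 *F τ ^F 2 *F (δ *F conj δ)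

    Δ≡Δ₀+a : ∀ X → Δ X ≡ Δ₀ X +F a
    Δ≡Δ₀+a X = begin
      G (tr (X +F a) +F δ) +F (X +F a) -F c *F F X
        ≡⟨ cong (λ e → G (e +F δ) +F (X +F a) -F c *F F X) (tr-+ X a) ⟩
      G (tr X +F t +F δ) +F (X +F a) -F c *F (G (tr X +F δ) +F X)
        ≡⟨ solve 5 (λ p₁ p₂ X a c → p₁ :+ (X :+ a) :- c :* (p₂ :+ X)
                                 := p₁ :+ c :* p₂ :+ (con true :+ c) :* X :+ a)
                   refl (G (tr X +F t +F δ)) (G (tr X +F δ)) X a c ⟩
      Δ₀ X +F a
        ∎

    tr[Δ₀]⁴ : ∀ X → tr (Δ₀ X) ^F 4 ≡ (1F +F c) ^F 4 *F linearized τ (tr X) +F κ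
    tr[Δ₀]⁴ X = begin
      tr (H u +F (1F +F c) *F X) ^F 4
        ≡⟨ cong (_^F 4) tr-split ⟩
      (A +F c *F B +F (1F +F c) *F u) ^F 4
        ≡⟨ solve 4 (λ A B u c → (A :+ c :* B :+ (con true :+ c) :* u) :^ 4
                              := A :^ 4 :+ c :^ 4 :* B :^ 4 :+ (con true :+ c) :^ 4 :* u :^ 4) refl A B u c ⟩
      A ^F 4 +F c ^F 4 *F B ^F 4 +F (1F +F c) ^F 4 *F u ^F 4
        ≡⟨ cong₂ (λ A⁴ B⁴ → A⁴ +F c ^F 4 *F B⁴ +F (1F +F c) ^F 4 *F u ^F 4)
                 (tr-G⁴-shift δ (conj-fixed-+ u-fixed (tr-fixed a))) (tr-G⁴-shift δ u-fixed) ⟩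
      (u +F t +F δ) *F (u +F t +F conj δ) *F τ ^F 2 +F c ^F 4 *F ((u +F δ) *F (u +F conj δ) *F τ ^F 2)
        +F (1F +F c) ^F 4 *F u ^F 4
        ≡⟨ solve 5 (λ u t d d′ c →
             (u :+ t :+ d) :* (u :+ t :+ d′) :* (d′ :+ d) :^ 2 :+ c :^ 4 :* ((u :+ d) :* (u :+ d′) :* (d′ :+ d) :^ 2)
               :+ (con true :+ c) :^ 4 :* u :^ 4
           := (con true :+ c) :^ 4 :* (u :^ 4 :+ (d′ :+ d) :^ 2 :* u :^ 2 :+ (d′ :+ d) :^ 3 :* u)
               :+ ((d′ :+ d) :^ 2 :* (t :^ 2 :+ t :* (d′ :+ d) :+ d :* d′)
                   :+ c :^ 4 :* (d′ :+ d) :^ 2 :* (d :* d′)))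
           refl u t δ (conj δ) c ⟩
      (1F +F c) ^F 4 *F linearized τ u +F κ
        ∎
      where
      u A B : Carrier
      u = tr X
      A = tr (G (u +F t +F δ))
      B = tr (G (u +F δ))
      u-fixed : conj u ≡ u
      u-fixed = tr-fixed X
      1+c-fixed : conj (1F +F c) ≡ 1F +F c
      1+c-fixed = conj-fixed-+ (1^n≡1 (2 ^ m)) c-fixed
      tr-split : tr (H u +F (1F +F c) *F X) ≡ A +F c *F B +F (1F +F c) *F u
      tr-split = begin
        tr (H u +F (1F +F c) *F X)                          ≡⟨ tr-+ (H u) _ ⟩
        tr (H u) +F tr ((1F +F c) *F X)                     ≡⟨ cong₂ _+F_ (tr-+ _ _) (tr-*ˡ X 1+c-fixed) ⟩
        A +F tr (c *F G (u +F δ)) +F (1F +F c) *F u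
          ≡⟨ cong (λ e → A +F e +F (1F +F c) *F u) (tr-*ˡ _ c-fixed) ⟩
        A +F c *F B +F (1F +F c) *F u                       ∎

    Δ-injective : Injective _≡_ _≡_ Δ
    Δ-injective {X} {Y} ΔX≡ΔY = *-cancelˡ X Y (1+c≢0 c≢1) (+-cancelˡ (H (tr X)) _ _ (begin
      H (tr X) +F (1F +F c) *F X      ≡⟨ Δ₀X≡Δ₀Y ⟩
      H (tr Y) +F (1F +F c) *F Y      ≡⟨ cong (λ u → H u +F (1F +F c) *F Y) trX≡trY ⟨
      H (tr X) +F (1F +F c) *F Y      ∎))
      where
      Δ₀X≡Δ₀Y : Δ₀ X ≡ Δ₀ Y
      Δ₀X≡Δ₀Y = +-cancelʳ a _ _ (trans (sym (Δ≡Δ₀+a X)) (trans ΔX≡ΔY (Δ≡Δ₀+a Y)))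
      L[trX]≡L[trY] : linearized τ (tr X) ≡ linearized τ (tr Y)
      L[trX]≡L[trY] = *-cancelˡ _ _ (x^n≢0 4 (1+c≢0 c≢1)) (+-cancelʳ κ _ _ (begin
        (1F +F c) ^F 4 *F linearized τ (tr X) +F κ   ≡⟨ tr[Δ₀]⁴ X ⟨
        tr (Δ₀ X) ^F 4                               ≡⟨ cong (λ z → tr z ^F 4) Δ₀X≡Δ₀Y ⟩
        tr (Δ₀ Y) ^F 4                               ≡⟨ tr[Δ₀]⁴ Y ⟩
        (1F +F c) ^F 4 *F linearized τ (tr Y) +F κ   ∎))
      trX≡trY : tr X ≡ tr Y
      trX≡trY = linearized-injective m 3∤m (tr-fixed δ) (tr-fixed X) (tr-fixed Y) L[trX]≡L[trY]

theorem3p2 : (m : ℕ) → 1 ≤ m → m % 3 ≢ 0 → (K : FiniteField (2 ^ (2 * m)))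
    → (δ : FiniteField.Carrier K)
    → (c : FiniteField.Carrier K)
    → FiniteField._^F_ K c (2 ^ m) ≡ c
    → c ≢ FiniteField.1F K
    → FiniteField.PcN K (Fmap K m δ) c
theorem3p2 m 1≤m 3∤m K δ c c-fixed c≢1 =
  PcN-if-derivatives-injective K (Fmap K m δ) c c≢1 (Derivative.Δ-injective 3∤m δ c c-fixed c≢1)
  where
  open FiniteField K using (_+F_; 0F; 1F)
  1+1≡0 : 1F +F 1F ≡ 0F
  1+1≡0 = Characteristic.characteristic-two K (2 * m) (ℕ.≤-trans 1≤m (ℕ.m≤n*m m 2)) refl
  open QuadraticExtension K 1+1≡0 m 1≤m (fermat K)
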